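{- For every integer $k\geq 6$, $\alpha_{\mathbb{Z}}(k)=\beta_{\mathbb{Z}}(k)=1$.
   Context: Let $S\subseteq\mathbb{Z}$. A permutation of $S$ is a sequence $p_1,p_2,\dots$ in which every element of $S$ appears exactly once. It contains an arithmetic progression of length $k$ if there are indices $i_1<\dots<i_k$ and integers $a$ and $d\neq 0$ (possibly negative) with $p_{i_j}=a+(j-1)d$ for all $j$. $S$ can be permuted to avoid arithmetic progressions of length $k$ if some permutation of $S$ contains no arithmetic progression of length $k$. Define $\alpha_{\mathbb{Z}}(k)$ as the supremum of $\limsup_{n\to\infty}\frac{|S\cap[-n,n]|}{2n}$, and $\beta_{\mathbb{Z}}(k)$ as the supremum of $\liminf_{n\to\infty}\frac{|S\cap[-n,n]|}{2n}$, each supremum taken over all sets $S\subseteq\mathbb{Z}$ that can be permuted to avoid arithmetic progressions of length $k$. -}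

module Defs where

open import Data.Bool using (Bool; true)
open import Data.Nat as ℕ using (ℕ; suc)
open import Data.Integer as ℤ using (ℤ; +_; 0ℤ)
open import Data.Fin as Fin using (Fin; toℕ)
open import Data.List using (List; length; filterᵇ; map; upTo; lookup)
open import Data.List.Relation.Unary.Unique.Propositional using (Unique)
open import Data.List.Membership.Propositional using (_∈_)
open import Data.Rational as ℚ using (ℚ; 0ℚ; 1ℚ; _/_)
open import Data.Product using (Σ; ∃; _×_)
open import Data.Sum using (_⊎_)
open import Relation.Binary.PropositionalEquality using (_≡_; _≢_)
open import Function.Bundles using (_⇔_)

SubsetZ : Set
SubsetZ = ℤ → Bool

-- An arithmetic progression of length k in an infinite sequence p₁,p₂,… :
-- strictly increasing indices i₁<…<i_k and integers a, d ≠ 0 with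
-- p_{i_j} = a + (j-1) d  (here j is 0-based, j : Fin k).
HasAPSeq : ℕ → (ℕ → ℤ) → Set
HasAPSeq k p =
  Σ (Fin k → ℕ) λ idx →
    (∀ i j → i Fin.< j → idx i ℕ.< idx j) ×
    Σ ℤ λ a → Σ ℤ λ d → d ≢ 0ℤ × (∀ j → p (idx j) ≡ a ℤ.+ (+ toℕ j) ℤ.* d)

HasAPList : ℕ → List ℤ → Set
HasAPList k l =
  Σ (Fin k → Fin (length l)) λ idx →
    (∀ i j → i Fin.< j → idx i Fin.< idx j) ×
    Σ ℤ λ a → Σ ℤ λ d → d ≢ 0ℤ × (∀ j → lookup l (idx j) ≡ a ℤ.+ (+ toℕ j) ℤ.* d)

IsFinitePermutation : SubsetZ → List ℤ → Set
IsFinitePermutation S l = Unique l × (∀ z → (S z ≡ true) ⇔ (z ∈ l))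

IsInfinitePermutation : SubsetZ → (ℕ → ℤ) → Set
IsInfinitePermutation S p =
  (∀ m n → p m ≡ p n → m ≡ n) ×
  (∀ n → S (p n) ≡ true) ×
  (∀ z → S z ≡ true → ∃ λ n → p n ≡ z)

CanAvoidAP : ℕ → SubsetZ → Set
CanAvoidAP k S =
  (Σ (List ℤ) λ l → IsFinitePermutation S l × (HasAPList k l → ⊥'))
  ⊎ (Σ (ℕ → ℤ) λ p → IsInfinitePermutation S p × (HasAPSeq k p → ⊥'))
  where open import Data.Empty renaming (⊥ to ⊥')

-- |S ∩ [-n, n]|
count : SubsetZ → ℕ → ℕ
count S n = length (filterᵇ S (map (λ i → (+ i) ℤ.- (+ n)) (upTo (suc (n ℕ.+ n)))))

-- density S n = |S ∩ [-(n+1), n+1]| / (2(n+1))   (radius shifted by one to avoid n = 0)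
density : SubsetZ → ℕ → ℚ
density S n = (+ count S (suc n)) / (2 ℕ.* suc n)

-- α_ℤ(k) = 1, i.e. sup over avoidable S of limsup density equals 1:
--  (i) every avoidable S has limsup density ≤ 1;
--  (ii) for every ε > 0 some avoidable S has limsup density ≥ 1 - ε
--       (stated as: density > 1 - ε for infinitely many n).
AlphaIsOne : ℕ → Set
AlphaIsOne k =
  (∀ S → CanAvoidAP k S → ∀ (ε : ℚ) → 0ℚ ℚ.< ε →
     ∃ λ N → ∀ n → N ℕ.≤ n → density S n ℚ.≤ 1ℚ ℚ.+ ε) ×
  (∀ (ε : ℚ) → 0ℚ ℚ.< ε → Σ SubsetZ λ S → CanAvoidAP k S ×
     (∀ N → ∃ λ n → N ℕ.≤ n × 1ℚ ℚ.- ε ℚ.< density S n))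

-- β_ℤ(k) = 1, i.e. sup over avoidable S of liminf density equals 1:
--  (i) every avoidable S has liminf density ≤ 1;
--  (ii) for every ε > 0 some avoidable S has liminf density ≥ 1 - ε
--       (stated as: density > 1 - ε for all sufficiently large n).
BetaIsOne : ℕ → Set
BetaIsOne k =
  (∀ S → CanAvoidAP k S → ∀ (ε : ℚ) → 0ℚ ℚ.< ε →
     ∀ N → ∃ λ n → N ℕ.≤ n × density S n ℚ.≤ 1ℚ ℚ.+ ε) ×
  (∀ (ε : ℚ) → 0ℚ ℚ.< ε → Σ SubsetZ λ S → CanAvoidAP k S ×
     (∃ λ N → ∀ n → N ℕ.≤ n → 1ℚ ℚ.- ε ℚ.< density S n))

module Submission where

-- For k ≥ 6 the whole of ℤ can be permuted so as to avoid k-term arithmetic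
-- progressions.  As ℤ has density 1 and no set has density above 1, this
-- gives α(k) = β(k) = 1.
--
-- The permutation `perm` lists 0 and -1, then for m = 0, 1, 2, … the shell
-- of integers of magnitude in [16^m, 16^(m+1)).  Each shell is listed free of
-- 3-term progressions: its elements are the centred residues, modulo
-- 2^(5+4m), of an interval, taken in the "evens first" (bit-reversal) order,
-- which has no 3-term progression even modulo a power of two (`order-no3AP`).
-- So in a 6-term progression x₀,…,x₅ the terms x₁, x₃, x₅ lie in strictly
-- increasing shells, forcing |x₅| ≥ 16·max(|x₀|, |x₁|) and contradicting
-- x₅ = 5x₁ - 4x₀ (`perm-no6AP`).  The file develops in turn: the evens-first
-- enumeration, geometric levels, centred residues, the shells, the
-- permutation, the growth argument, the density estimates, and the theorem.

open import Data.Bool using (true)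
open import Data.Nat
open import Data.Nat.Properties
open import Data.Nat.Tactic.RingSolver using (solve-∀)
open import Data.Integer as ℤ using (ℤ; +_; -[1+_]; ∣_∣)
import Data.Integer.Properties as ℤ
import Data.Integer.Tactic.RingSolver as ℤSolver
open import Data.Rational as ℚ using (mkℚ; 0ℚ; 1ℚ)
import Data.Rational.Properties as ℚ
open import Data.Rational.Unnormalised as ℚᵘ using (mkℚᵘ)
import Data.Rational.Unnormalised.Properties as ℚᵘ
open import Data.Fin using (Fin; #_; toℕ; inject≤)
open import Data.Fin.Properties using (toℕ-inject≤)
open import Data.List using (List; []; _∷_; length; filterᵇ; map; upTo)
import Data.List.Properties as List
open import Data.Empty using (⊥)
open import Data.Product using (∃; _×_; _,_; proj₁; proj₂)
open import Data.Sum using (_⊎_; inj₁; inj₂)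
open import Function using (_∘_)
open import Relation.Nullary using (¬_; yes; no; contradiction)
open import Relation.Nullary.Decidable using (T?)
open import Relation.Binary.PropositionalEquality
open import Defs

-- Halving an index range [0, L): the first ⌈L/2⌉ indices address the even
-- numbers below L, the remaining ⌊L/2⌋ indices address the odd ones.
double<⇒<⌈/2⌉ : ∀ x L → 2 * x < L → x < ⌈ L /2⌉
double<⇒<⌈/2⌉ zero    (suc L)       _  = z<s
double<⇒<⌈/2⌉ (suc x) (suc zero)    (s≤s ())
double<⇒<⌈/2⌉ (suc x) (suc (suc L)) lt =
  s<s (double<⇒<⌈/2⌉ x L (≤-pred (≤-pred (subst (_< suc (suc L)) (*-suc 2 x) lt))))

<⌈/2⌉⇒double< : ∀ x L → x < ⌈ L /2⌉ → 2 * x < L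
<⌈/2⌉⇒double< zero    (suc L)       _  = z<s
<⌈/2⌉⇒double< (suc x) (suc zero)    (s≤s ())
<⌈/2⌉⇒double< (suc x) (suc (suc L)) lt =
  subst (_< suc (suc L)) (sym (*-suc 2 x)) (s<s (s<s (<⌈/2⌉⇒double< x L (≤-pred lt))))

double+1<⇒<⌊/2⌋ : ∀ x L → suc (2 * x) < L → x < ⌊ L /2⌋
double+1<⇒<⌊/2⌋ x       (suc zero)    (s≤s ())
double+1<⇒<⌊/2⌋ zero    (suc (suc L)) _  = z<s
double+1<⇒<⌊/2⌋ (suc x) (suc (suc L)) lt =
  s<s (double+1<⇒<⌊/2⌋ x L (≤-pred (≤-pred (subst (λ y → suc y < suc (suc L)) (*-suc 2 x) lt))))

<⌊/2⌋⇒double+1< : ∀ x L → x < ⌊ L /2⌋ → suc (2 * x) < L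
<⌊/2⌋⇒double+1< zero    (suc (suc L)) _  = s<s z<s
<⌊/2⌋⇒double+1< (suc x) (suc (suc L)) lt =
  subst (λ y → suc y < suc (suc L)) (sym (*-suc 2 x)) (s<s (s<s (<⌊/2⌋⇒double+1< x L (≤-pred lt))))

⌈/2⌉-≤-half : ∀ K L → L ≤ 2 ^ suc K → ⌈ L /2⌉ ≤ 2 ^ K
⌈/2⌉-≤-half K L L≤ = begin
  ⌈ L /2⌉                  ≤⟨ ⌈n/2⌉-mono L≤ ⟩
  ⌈ 2 ^ K + (2 ^ K + 0) /2⌉ ≡⟨ cong (λ n → ⌈ 2 ^ K + n /2⌉) (+-identityʳ (2 ^ K)) ⟩
  ⌈ 2 ^ K + 2 ^ K /2⌉       ≡⟨ n≡⌈n+n/2⌉ (2 ^ K) ⟨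
  2 ^ K ∎
  where open ≤-Reasoning

⌊/2⌋-≤-half : ∀ K L → L ≤ 2 ^ suc K → ⌊ L /2⌋ ≤ 2 ^ K
⌊/2⌋-≤-half K L L≤ = ≤-trans (⌊n/2⌋≤⌈n/2⌉ L) (⌈/2⌉-≤-half K L L≤)

-- The "evens first" enumeration of [0, L) for L ≤ 2^K: the even numbers
-- (enumerated recursively) followed by the odd ones.  For L = 2^K this is
-- the bit-reversal permutation.
order : ℕ → ℕ → ℕ → ℕ
order zero    L r = 0
order (suc K) L r with r <? ⌈ L /2⌉
... | yes _ = 2 * order K ⌈ L /2⌉ r
... | no  _ = suc (2 * order K ⌊ L /2⌋ (r ∸ ⌈ L /2⌉))

order-front : ∀ K L r → r < ⌈ L /2⌉ → order (suc K) L r ≡ 2 * order K ⌈ L /2⌉ r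
order-front K L r r<h with r <? ⌈ L /2⌉
... | yes _   = refl
... | no  r≮h = contradiction r<h r≮h

order-back : ∀ K L r → ¬ r < ⌈ L /2⌉ →
             order (suc K) L r ≡ suc (2 * order K ⌊ L /2⌋ (r ∸ ⌈ L /2⌉))
order-back K L r r≮h with r <? ⌈ L /2⌉
... | yes r<h = contradiction r<h r≮h
... | no  _   = refl

data Half (K L r : ℕ) : Set where
  front : r < ⌈ L /2⌉ → order (suc K) L r ≡ 2 * order K ⌈ L /2⌉ r → Half K L r
  back  : ∀ s → r ≡ ⌈ L /2⌉ + s → s < ⌊ L /2⌋ →
          order (suc K) L r ≡ suc (2 * order K ⌊ L /2⌋ s) → Half K L r

half : ∀ K L r → r < L → Half K L r
half K L r r<L with r <? ⌈ L /2⌉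
... | yes r<h = front r<h (order-front K L r r<h)
... | no  r≮h = back (r ∸ h) (sym (m+[n∸m]≡n h≤r)) s<⌊L/2⌋ (order-back K L r r≮h)
  where
  h = ⌈ L /2⌉
  h≤r : h ≤ r
  h≤r = ≮⇒≥ r≮h
  s<⌊L/2⌋ : r ∸ h < ⌊ L /2⌋
  s<⌊L/2⌋ = subst (r ∸ h <_) (trans (cong (_∸ h) (sym (⌊n/2⌋+⌈n/2⌉≡n L))) (m+n∸n≡m ⌊ L /2⌋ h))
                  (∸-monoˡ-< r<L h≤r)

index-≤1 : ∀ {L r} → L ≤ 1 → r < L → r ≡ 0
index-≤1 (s≤s z≤n) (s≤s z≤n) = refl

order-< : ∀ K L r → L ≤ 2 ^ K → r < L → order K L r < L
order-< zero    L r _  r<L = ≤-<-trans z≤n r<L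
order-< (suc K) L r L≤ r<L with half K L r r<L
... | front r<h eq = subst (_< L) (sym eq)
  (<⌈/2⌉⇒double< _ L (order-< K ⌈ L /2⌉ r (⌈/2⌉-≤-half K L L≤) r<h))
... | back s _ s<h eq = subst (_< L) (sym eq)
  (<⌊/2⌋⇒double+1< _ L (order-< K ⌊ L /2⌋ s (⌊/2⌋-≤-half K L L≤) s<h))

order-injective : ∀ K L {r r′} → L ≤ 2 ^ K → r < L → r′ < L →
                  order K L r ≡ order K L r′ → r ≡ r′
order-injective zero L L≤ r<L r′<L _ = trans (index-≤1 L≤ r<L) (sym (index-≤1 L≤ r′<L))
order-injective (suc K) L {r} {r′} L≤ r<L r′<L eq with half K L r r<L | half K L r′ r′<L
... | front r<h e | front r′<h e′ =
  order-injective K ⌈ L /2⌉ (⌈/2⌉-≤-half K L L≤) r<h r′<h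
    (*-cancelˡ-≡ _ _ 2 (trans (sym e) (trans eq e′)))
... | front _ e | back s′ _ _ e′ =
  contradiction (trans (sym e) (trans eq e′)) (even≢odd (order K ⌈ L /2⌉ r) (order K ⌊ L /2⌋ s′))
... | back s _ _ e | front _ e′ =
  contradiction (trans (sym e′) (trans (sym eq) e)) (even≢odd (order K ⌈ L /2⌉ r′) (order K ⌊ L /2⌋ s))
... | back s r≡ s<h e | back s′ r′≡ s′<h e′ =
  trans r≡ (trans (cong (λ s → ⌈ L /2⌉ + s) s≡s′) (sym r′≡))
  where
  s≡s′ : s ≡ s′
  s≡s′ = order-injective K ⌊ L /2⌋ (⌊/2⌋-≤-half K L L≤) s<h s′<h
           (*-cancelˡ-≡ _ _ 2 (suc-injective (trans (sym e) (trans eq e′))))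

even-or-odd : ∀ x → ∃ λ y → x ≡ 2 * y ⊎ x ≡ suc (2 * y)
even-or-odd zero = 0 , inj₁ refl
even-or-odd (suc x) with even-or-odd x
... | y , inj₁ x≡2y   = y , inj₂ (cong suc x≡2y)
... | y , inj₂ x≡2y+1 = suc y , inj₁ (trans (cong suc x≡2y+1) (sym (*-suc 2 y)))

order-onto : ∀ K L x → L ≤ 2 ^ K → x < L → ∃ λ r → r < L × order K L r ≡ x
order-onto zero L x L≤ x<L = 0 , ≤-<-trans z≤n x<L , sym (index-≤1 L≤ x<L)
order-onto (suc K) L x L≤ x<L with even-or-odd x
... | y , inj₁ refl =
  let (r , r<h , eq) = order-onto K ⌈ L /2⌉ y (⌈/2⌉-≤-half K L L≤) (double<⇒<⌈/2⌉ y L x<L)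
  in r , <-≤-trans r<h (⌈n/2⌉≤n L) , trans (order-front K L r r<h) (cong (2 *_) eq)
... | y , inj₂ refl =
  let (s , s<h , eq) = order-onto K ⌊ L /2⌋ y (⌊/2⌋-≤-half K L L≤) (double+1<⇒<⌊/2⌋ y L x<L)
      h = ⌈ L /2⌉
      h+s<L : h + s < L
      h+s<L = subst (h + s <_) (trans (+-comm h ⌊ L /2⌋) (⌊n/2⌋+⌈n/2⌉≡n L)) (+-monoʳ-< h s<h)
  in h + s , h+s<L ,
     trans (order-back K L (h + s) (≤⇒≯ (m≤m+n h s)))
           (cong (λ t → suc (2 * t)) (trans (cong (order K ⌊ L /2⌋) (m+n∸m≡n h s)) eq))

data Congruent (M a b : ℕ) : Set where
  congruent : ∀ q q′ → a + q * M ≡ b + q′ * M → Congruent M a b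

congruent-halve : ∀ M a b → Congruent (2 * M) (2 * a) (2 * b) → Congruent M a b
congruent-halve M a b (congruent q q′ eq) = congruent q q′ (*-cancelˡ-≡ _ _ 2 (begin
  2 * (a + q * M)       ≡⟨ factor a q M ⟩
  2 * a + q * (2 * M)   ≡⟨ eq ⟩
  2 * b + q′ * (2 * M)  ≡⟨ factor b q′ M ⟨
  2 * (b + q′ * M)      ∎))
  where
  open ≡-Reasoning
  factor : ∀ a q M → 2 * (a + q * M) ≡ 2 * a + q * (2 * M)
  factor = solve-∀

odd≇even : ∀ M a b → ¬ Congruent (2 * M) (suc (2 * a)) (2 * b)
odd≇even M a b (congruent q q′ eq) = even≢odd (b + q′ * M) (a + q * M) (begin
  2 * (b + q′ * M)           ≡⟨ factor b q′ M ⟩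
  2 * b + q′ * (2 * M)       ≡⟨ eq ⟨
  suc (2 * a) + q * (2 * M)  ≡⟨ cong suc (factor a q M) ⟨
  suc (2 * (a + q * M))      ∎)
  where
  open ≡-Reasoning
  factor : ∀ a q M → 2 * (a + q * M) ≡ 2 * a + q * (2 * M)
  factor = solve-∀

congruent-pred : ∀ M a b → Congruent M (suc a) (suc b) → Congruent M a b
congruent-pred M a b (congruent q q′ eq) = congruent q q′ (suc-injective eq)

congruent-cancel : ∀ {M} c a b → Congruent M (c + a) (c + b) → Congruent M a b
congruent-cancel {M} c a b (congruent q q′ eq) = congruent q q′ (+-cancelˡ-≡ c _ _ (begin
  c + (a + q * M)   ≡⟨ +-assoc c a (q * M) ⟨
  c + a + q * M     ≡⟨ eq ⟩
  c + b + q′ * M    ≡⟨ +-assoc c b (q′ * M) ⟩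
  c + (b + q′ * M)  ∎))
  where open ≡-Reasoning

-- Parity of the sum of the outer terms of a triple split across the halves.
even+odd : ∀ a c → 2 * a + suc (2 * c) ≡ suc (2 * (a + c))
even+odd = solve-∀

odd+odd : ∀ a c → suc (2 * a) + suc (2 * c) ≡ 2 * suc (a + c)
odd+odd = solve-∀

back-before-front : ∀ {h s r r′} → r ≡ h + s → r′ < h → r < r′ → ⊥
back-before-front {h} {s} refl r′<h r<r′ = <⇒≱ (<-trans r<r′ r′<h) (m≤m+n h s)

-- The enumeration contains no 3-term progression, even modulo 2^K: this is
-- the classical parity argument (both halves reduce to the case K, and a
-- mixed triple has an odd sum of its outer terms).
order-no3AP : ∀ K L {r₁ r₂ r₃} → L ≤ 2 ^ K → r₁ < r₂ → r₂ < r₃ → r₃ < L →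
              ¬ Congruent (2 ^ K) (order K L r₁ + order K L r₃) (2 * order K L r₂)
order-no3AP zero L L≤ r₁<r₂ r₂<r₃ r₃<L _ =
  <⇒≱ (<-≤-trans r₂<r₃ (≤-reflexive (index-≤1 L≤ r₃<L))) z≤n
order-no3AP (suc K) L {r₁} {r₂} {r₃} L≤ r₁<r₂ r₂<r₃ r₃<L ap
  with half K L r₁ (<-trans r₁<r₂ (<-trans r₂<r₃ r₃<L))
     | half K L r₂ (<-trans r₂<r₃ r₃<L) | half K L r₃ r₃<L
... | front _ e₁ | front _ e₂ | front r₃<h e₃ =
  order-no3AP K ⌈ L /2⌉ (⌈/2⌉-≤-half K L L≤) r₁<r₂ r₂<r₃ r₃<h
    (congruent-halve (2 ^ K) (A r₁ + A r₃) (2 * A r₂)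
      (subst₂ (Congruent (2 ^ suc K)) (trans (cong₂ _+_ e₁ e₃) (sym (*-distribˡ-+ 2 (A r₁) (A r₃))))
              (cong (2 *_) e₂) ap))
  where A = order K ⌈ L /2⌉
... | front _ e₁ | front _ e₂ | back s₃ _ _ e₃ =
  odd≇even (2 ^ K) (A r₁ + B s₃) (2 * A r₂)
    (subst₂ (Congruent (2 ^ suc K)) (trans (cong₂ _+_ e₁ e₃) (even+odd (A r₁) (B s₃))) (cong (2 *_) e₂) ap)
  where A = order K ⌈ L /2⌉ ; B = order K ⌊ L /2⌋
... | front _ e₁ | back s₂ _ _ e₂ | back s₃ _ _ e₃ =
  odd≇even (2 ^ K) (A r₁ + B s₃) (suc (2 * B s₂))
    (subst₂ (Congruent (2 ^ suc K)) (trans (cong₂ _+_ e₁ e₃) (even+odd (A r₁) (B s₃))) (cong (2 *_) e₂) ap)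
  where A = order K ⌈ L /2⌉ ; B = order K ⌊ L /2⌋
... | back s₁ r₁≡ _ e₁ | back s₂ r₂≡ _ e₂ | back s₃ r₃≡ s₃<h e₃ =
  order-no3AP K ⌊ L /2⌋ (⌊/2⌋-≤-half K L L≤) (shift r₁≡ r₂≡ r₁<r₂) (shift r₂≡ r₃≡ r₂<r₃) s₃<h
    (congruent-pred (2 ^ K) (B s₁ + B s₃) (2 * B s₂)
      (congruent-halve (2 ^ K) (suc (B s₁ + B s₃)) (suc (2 * B s₂))
        (subst₂ (Congruent (2 ^ suc K)) (trans (cong₂ _+_ e₁ e₃) (odd+odd (B s₁) (B s₃))) (cong (2 *_) e₂) ap)))
  where
  B = order K ⌊ L /2⌋
  shift : ∀ {r r′ s s′} → r ≡ ⌈ L /2⌉ + s → r′ ≡ ⌈ L /2⌉ + s′ → r < r′ → s < s′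
  shift refl refl = +-cancelˡ-< ⌈ L /2⌉ _ _
... | back _ r₁≡ _ _ | front r₂<h _ | _ = back-before-front r₁≡ r₂<h r₁<r₂
... | _ | back _ r₂≡ _ _ | front r₃<h _ = back-before-front r₂≡ r₃<h r₂<r₃

record InLevel (c m n : ℕ) : Set where
  constructor inLevel
  field
    lower : c * 16 ^ m ≤ n
    upper : n < c * 16 ^ suc m

level-exists : ∀ c .{{_ : NonZero c}} j → ∃ λ m → InLevel c m (c + j)
level-exists c zero =
  0 , inLevel (≤-reflexive (trans (*-identityʳ c) (sym (+-identityʳ c))))
  (subst₂ _<_ (sym (+-identityʳ c)) (cong (c *_) (sym (*-identityʳ 16))) (m<m*n c 16 (s≤s (s≤s z≤n))))
level-exists c (suc j) with level-exists c j
... | m , inLevel lo hi with c + suc j <? c * 16 ^ suc m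
...   | yes hi′ = m , inLevel (≤-trans lo (+-monoʳ-≤ c (n≤1+n j))) hi′
...   | no  hi̸ = suc m , inLevel (≮⇒≥ hi̸) (begin-strict
  c + suc j           ≡⟨ +-suc c j ⟩
  suc (c + j)         ≤⟨ hi ⟩
  c * 16 ^ suc m      <⟨ *-monoʳ-< c (^-monoʳ-< 16 (s≤s (s≤s z≤n)) (n<1+n (suc m))) ⟩
  c * 16 ^ suc (suc m) ∎)
  where open ≤-Reasoning

inLevel-mono : ∀ {c m m′ n n′} → InLevel c m n → InLevel c m′ n′ → n ≤ n′ → m ≤ m′
inLevel-mono {c} {m} {m′} {n} {n′} (inLevel lo _) (inLevel _ hi′) n≤n′ with m ≤? m′
... | yes m≤m′ = m≤m′
... | no  m≰m′ = contradiction (begin-strict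
  n′               <⟨ hi′ ⟩
  c * 16 ^ suc m′  ≤⟨ *-monoʳ-≤ c (^-monoʳ-≤ 16 (≰⇒> m≰m′)) ⟩
  c * 16 ^ m       ≤⟨ lo ⟩
  n                ≤⟨ n≤n′ ⟩
  n′               ∎) (<-irrefl refl)
  where open ≤-Reasoning

inLevel-unique : ∀ {c m m′ n} → InLevel c m n → InLevel c m′ n → m ≡ m′
inLevel-unique l l′ = ≤-antisym (inLevel-mono l l′ ≤-refl) (inLevel-mono l′ l ≤-refl)

inLevel-≥ : ∀ {c m n} → InLevel c m n → c ≤ n
inLevel-≥ {c} {m} (inLevel lo _) = ≤-trans (m≤m*n c (16 ^ m) {{m^n≢0 16 m}}) lo

inLevel-between : ∀ {c m n₁ n₂ n₃} → InLevel c m n₁ → InLevel c m n₃ → n₁ ≤ n₂ → n₂ ≤ n₃ → InLevel c m n₂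
inLevel-between (inLevel lo _) (inLevel _ hi) n₁≤n₂ n₂≤n₃ = inLevel (≤-trans lo n₁≤n₂) (≤-<-trans n₂≤n₃ hi)

-- The magnitude of an integer in one's complement: z ↦ z for z ≥ 0 and
-- z ↦ -z-1 for z < 0.  Thus 0 and -1 have magnitude 0 and every other
-- magnitude is taken by exactly one positive and one negative integer.
mag : ℤ → ℕ
mag (+ u)    = u
mag -[1+ a ] = a

complement-involutive : ∀ {N x} → x < N → N ∸ suc (N ∸ suc x) ≡ x
complement-involutive {suc N} (s≤s x≤N) = m∸[m∸n]≡n x≤N

centre : ℕ → ℕ → ℤ
centre H ρ with ρ <? H
... | yes _ = + ρ
... | no  _ = -[1+ 2 * H ∸ suc ρ ]

residue : ℕ → ℤ → ℕ
residue H (+ u)    = u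
residue H -[1+ a ] = 2 * H ∸ suc a

centre-low : ∀ {H ρ} → ρ < H → centre H ρ ≡ + ρ
centre-low {H} {ρ} ρ<H with ρ <? H
... | yes _   = refl
... | no  ρ≮H = contradiction ρ<H ρ≮H

centre-high : ∀ {H ρ} → H ≤ ρ → centre H ρ ≡ -[1+ 2 * H ∸ suc ρ ]
centre-high {H} {ρ} H≤ρ with ρ <? H
... | yes ρ<H = contradiction H≤ρ (<⇒≱ ρ<H)
... | no  _   = refl

residue-centre : ∀ {H ρ} → ρ < 2 * H → residue H (centre H ρ) ≡ ρ
residue-centre {H} {ρ} ρ<2H with ρ <? H
... | yes _ = refl
... | no  _ = complement-involutive ρ<2H

double : ∀ H → 2 * H ≡ H + H
double H = cong (λ x → H + x) (+-identityʳ H)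

centre-residue : ∀ {H} z → mag z < H → centre H (residue H z) ≡ z
centre-residue (+ u) u<H = centre-low u<H
centre-residue {H} -[1+ a ] a<H =
  trans (centre-high H≤ρ) (cong -[1+_] (complement-involutive (<-≤-trans a<H (m≤n*m H 2))))
  where
  H≤ρ : H ≤ 2 * H ∸ suc a
  H≤ρ = begin
    H                ≡⟨ m+n∸n≡m H H ⟨
    H + H ∸ H        ≡⟨ cong (_∸ H) (double H) ⟨
    2 * H ∸ H        ≤⟨ ∸-monoʳ-≤ (2 * H) a<H ⟩
    2 * H ∸ suc a    ∎
    where open ≤-Reasoning

complement-< : ∀ {N x} → x < N → N ∸ suc x < N
complement-< {suc N} {x} _ = s≤s (m∸n≤m N x)

centre-mag : ∀ {P H ρ} → P ≤ ρ → ρ + P < 2 * H → P ≤ mag (centre H ρ) × mag (centre H ρ) < H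
centre-mag {P} {H} {ρ} P≤ρ ρ+P<2H with ρ <? H
... | yes ρ<H = P≤ρ , ρ<H
... | no  ρ≮H = +-cancelʳ-≤ (suc ρ) P a P+ρ<a+ρ , +-cancelʳ-< (suc ρ) a H a+ρ<H+ρ
  where
  open ≤-Reasoning
  a = 2 * H ∸ suc ρ
  a+ρ≡2H : a + suc ρ ≡ 2 * H
  a+ρ≡2H = m∸n+n≡m (≤-trans (s≤s (m≤m+n ρ P)) ρ+P<2H)
  P+ρ<a+ρ : P + suc ρ ≤ a + suc ρ
  P+ρ<a+ρ = begin
    P + suc ρ    ≡⟨ trans (+-suc P ρ) (cong suc (+-comm P ρ)) ⟩
    suc (ρ + P)  ≤⟨ ρ+P<2H ⟩
    2 * H        ≡⟨ a+ρ≡2H ⟨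
    a + suc ρ    ∎
  a+ρ<H+ρ : a + suc ρ < H + suc ρ
  a+ρ<H+ρ = begin-strict
    a + suc ρ  ≡⟨ trans a+ρ≡2H (double H) ⟩
    H + H      ≤⟨ +-monoʳ-≤ H (≮⇒≥ ρ≮H) ⟩
    H + ρ      <⟨ +-monoʳ-< H (n<1+n ρ) ⟩
    H + suc ρ  ∎

residue-range : ∀ {P H} z → P ≤ mag z → mag z < H → P ≤ residue H z × residue H z + P < 2 * H
residue-range {P} {H} (+ u) P≤u u<H =
  P≤u , subst (u + P <_) (sym (double H)) (+-mono-< u<H (≤-<-trans P≤u u<H))
residue-range {P} {H} -[1+ a ] P≤a a<H =
  +-cancelʳ-≤ (suc a) P ρ P+a≤ρ+a , subst (ρ + P <_) ρ+a≡2H (+-monoʳ-< ρ (s≤s P≤a))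
  where
  ρ = 2 * H ∸ suc a
  ρ+a≡2H : ρ + suc a ≡ 2 * H
  ρ+a≡2H = m∸n+n≡m (≤-trans a<H (m≤n*m H 2))
  P+a≤ρ+a : P + suc a ≤ ρ + suc a
  P+a≤ρ+a = subst (P + suc a ≤_) (trans (sym (double H)) (sym ρ+a≡2H))
                  (+-mono-≤ (<⇒≤ (≤-<-trans P≤a a<H)) a<H)

data IsResidue (M ρ : ℕ) (z : ℤ) : Set where
  isResidue : ∀ δ → + ρ ≡ z ℤ.+ + (δ * M) → IsResidue M ρ z

centre-congruent : ∀ {H ρ} → ρ < 2 * H → IsResidue (2 * H) ρ (centre H ρ)
centre-congruent {H} {ρ} ρ<2H with ρ <? H
... | yes _ = isResidue 0 (cong +_ (sym (+-identityʳ ρ)))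
... | no  _ = isResidue 1 (sym (begin
  (1 * (2 * H)) ℤ.⊖ suc a       ≡⟨ ℤ.⊖-≥ (subst (suc a ≤_) (sym (*-identityˡ (2 * H))) (complement-< ρ<2H)) ⟩
  + (1 * (2 * H) ∸ suc a)        ≡⟨ cong (λ t → + (t ∸ suc a)) (*-identityˡ (2 * H)) ⟩
  + (2 * H ∸ suc a)              ≡⟨ cong +_ (complement-involutive ρ<2H) ⟩
  + ρ                            ∎))
  where
  open ≡-Reasoning
  a = 2 * H ∸ suc ρ

ap-residues : ∀ {M ρ₁ ρ₂ ρ₃ z₁ z₂ z₃} →
  IsResidue M ρ₁ z₁ → IsResidue M ρ₂ z₂ → IsResidue M ρ₃ z₃ →
  z₁ ℤ.+ z₃ ≡ + 2 ℤ.* z₂ → Congruent M (ρ₁ + ρ₃) (2 * ρ₂)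
ap-residues {M} {ρ₁} {ρ₂} {ρ₃} {z₁} {z₂} {z₃} (isResidue δ₁ e₁) (isResidue δ₂ e₂) (isResidue δ₃ e₃) ap =
  congruent (2 * δ₂) (δ₁ + δ₃) (ℤ.+-injective (begin
    + (ρ₁ + ρ₃ + 2 * δ₂ * M)                       ≡⟨ cong (λ t → + (ρ₁ + ρ₃) ℤ.+ t)
                                                          (trans (cong +_ (*-assoc 2 δ₂ M)) (ℤ.pos-* 2 (δ₂ * M))) ⟩
    + ρ₁ ℤ.+ + ρ₃ ℤ.+ + 2 ℤ.* D₂                    ≡⟨ cong₂ (λ s t → s ℤ.+ t ℤ.+ + 2 ℤ.* D₂) e₁ e₃ ⟩
    (z₁ ℤ.+ D₁) ℤ.+ (z₃ ℤ.+ D₃) ℤ.+ + 2 ℤ.* D₂      ≡⟨ separate z₁ z₃ D₁ D₂ D₃ ⟩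
    (z₁ ℤ.+ z₃) ℤ.+ (+ 2 ℤ.* D₂ ℤ.+ (D₁ ℤ.+ D₃))    ≡⟨ cong (ℤ._+ (+ 2 ℤ.* D₂ ℤ.+ (D₁ ℤ.+ D₃))) ap ⟩
    + 2 ℤ.* z₂ ℤ.+ (+ 2 ℤ.* D₂ ℤ.+ (D₁ ℤ.+ D₃))     ≡⟨ regroup z₂ D₁ D₂ D₃ ⟩
    + 2 ℤ.* (z₂ ℤ.+ D₂) ℤ.+ (D₁ ℤ.+ D₃)            ≡⟨ cong (λ t → + 2 ℤ.* t ℤ.+ (D₁ ℤ.+ D₃)) e₂ ⟨
    + 2 ℤ.* + ρ₂ ℤ.+ (D₁ ℤ.+ D₃)                   ≡⟨ cong₂ ℤ._+_ (ℤ.pos-* 2 ρ₂) (cong +_ (*-distribʳ-+ M δ₁ δ₃)) ⟨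
    + (2 * ρ₂ + (δ₁ + δ₃) * M)                     ∎))
  where
  open ≡-Reasoning
  D₁ = + (δ₁ * M)
  D₂ = + (δ₂ * M)
  D₃ = + (δ₃ * M)
  separate : ∀ z₁ z₃ D₁ D₂ D₃ →
    (z₁ ℤ.+ D₁) ℤ.+ (z₃ ℤ.+ D₃) ℤ.+ + 2 ℤ.* D₂ ≡ (z₁ ℤ.+ z₃) ℤ.+ (+ 2 ℤ.* D₂ ℤ.+ (D₁ ℤ.+ D₃))
  separate = ℤSolver.solve-∀
  regroup : ∀ z₂ D₁ D₂ D₃ →
    + 2 ℤ.* z₂ ℤ.+ (+ 2 ℤ.* D₂ ℤ.+ (D₁ ℤ.+ D₃)) ≡ + 2 ℤ.* (z₂ ℤ.+ D₂) ℤ.+ (D₁ ℤ.+ D₃)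
  regroup = ℤSolver.solve-∀

-- The shell of level m: integers whose magnitude lies in [16^m, 16^(m+1)).
-- It has 30·16^m elements.
record InShell (m : ℕ) (z : ℤ) : Set where
  constructor inShell
  field
    shell-lower : 16 ^ m ≤ mag z
    shell-upper : mag z < 16 ^ suc m
open InShell

shell⇒level : ∀ {m z} → InShell m z → InLevel 1 m (mag z)
shell⇒level {m} {z} (inShell lo hi) = inLevel (subst (_≤ mag z) (sym (*-identityˡ (16 ^ m))) lo)
                                             (subst (mag z <_) (sym (*-identityˡ (16 ^ suc m))) hi)

level⇒shell : ∀ {m z} → InLevel 1 m (mag z) → InShell m z
level⇒shell {m} {z} (inLevel lo hi) = inShell (subst (_≤ mag z) (*-identityˡ (16 ^ m)) lo)
                                             (subst (mag z <_) (*-identityˡ (16 ^ suc m)) hi)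

-- The modulus used at level m is 2^(5+4m) = 2·16^(m+1), a power of two
-- exceeding the 30·16^m indices of the shell.
modulus : ∀ m → 2 ^ (5 + 4 * m) ≡ 2 * 16 ^ suc m
modulus m = begin
  2 ^ (5 + 4 * m)      ≡⟨ ^-distribˡ-+-* 2 5 (4 * m) ⟩
  32 * 2 ^ (4 * m)     ≡⟨ cong (32 *_) (^-*-assoc 2 4 m) ⟨
  32 * 16 ^ m          ≡⟨ thirty-two (16 ^ m) ⟩
  2 * 16 ^ suc m       ∎
  where
  open ≡-Reasoning
  thirty-two : ∀ p → 32 * p ≡ 2 * (16 * p)
  thirty-two = solve-∀

shellElem : ℕ → ℕ → ℤ
shellElem m r = centre (16 ^ suc m) (16 ^ m + order (5 + 4 * m) (30 * 16 ^ m) r)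

module _ (m : ℕ) where
  private
    P H K L : ℕ
    P = 16 ^ m
    H = 16 ^ suc m
    K = 5 + 4 * m
    L = 30 * P

    L≤2^K : L ≤ 2 ^ K
    L≤2^K = begin
      30 * P    ≤⟨ *-monoˡ-≤ P {30} {32} (m≤m+n 30 2) ⟩
      32 * P    ≡⟨ thirty-two P ⟩
      2 * H     ≡⟨ modulus m ⟨
      2 ^ K     ∎
      where
      open ≤-Reasoning
      thirty-two : ∀ p → 32 * p ≡ 2 * (16 * p)
      thirty-two = solve-∀

    residue-bound : ∀ {x} → x < L → P + x + P < 2 * H
    residue-bound {x} x<L = begin-strict
      P + x + P          <⟨ +-monoˡ-< P (+-monoʳ-< P x<L) ⟩
      P + 30 * P + P     ≡⟨ thirty-two P ⟩
      2 * H              ∎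
      where
      open ≤-Reasoning
      thirty-two : ∀ p → p + 30 * p + p ≡ 2 * (16 * p)
      thirty-two = solve-∀

    index-bound : ∀ {ρ} → P ≤ ρ → ρ + P < 2 * H → ρ ∸ P < L
    index-bound {ρ} P≤ρ ρ+P<2H = +-cancelˡ-< P (ρ ∸ P) L (+-cancelʳ-< P (P + (ρ ∸ P)) (P + L) (begin-strict
      P + (ρ ∸ P) + P  ≡⟨ cong (_+ P) (m+[n∸m]≡n P≤ρ) ⟩
      ρ + P            <⟨ ρ+P<2H ⟩
      2 * H            ≡⟨ thirty-two P ⟩
      P + L + P        ∎))
      where
      open ≤-Reasoning
      thirty-two : ∀ p → 2 * (16 * p) ≡ p + 30 * p + p
      thirty-two = solve-∀

    residue< : ∀ r → r < L → P + order K L r < 2 * H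
    residue< r r<L = ≤-<-trans (m≤m+n _ P) (residue-bound (order-< K L r L≤2^K r<L))

  shellElem-inShell : ∀ r → r < L → InShell m (shellElem m r)
  shellElem-inShell r r<L =
    let (lo , hi) = centre-mag {P} {H} (m≤m+n P (order K L r)) (residue-bound (order-< K L r L≤2^K r<L))
    in inShell lo hi

  shellElem-injective : ∀ {r r′} → r < L → r′ < L → shellElem m r ≡ shellElem m r′ → r ≡ r′
  shellElem-injective {r} {r′} r<L r′<L eq =
    order-injective K L L≤2^K r<L r′<L (+-cancelˡ-≡ P _ _ (begin
      P + order K L r                 ≡⟨ residue-centre {H} (residue< r r<L) ⟨
      residue H (shellElem m r)       ≡⟨ cong (residue H) eq ⟩
      residue H (shellElem m r′)      ≡⟨ residue-centre {H} (residue< r′ r′<L) ⟩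
      P + order K L r′                ∎))
    where open ≡-Reasoning

  shellElem-onto : ∀ z → InShell m z → ∃ λ r → r < L × shellElem m r ≡ z
  shellElem-onto z z∈ =
    let (P≤ρ , ρ+P<2H) = residue-range {P} {H} z (shell-lower z∈) (shell-upper z∈)
        x = residue H z ∸ P
        (r , r<L , order≡x) = order-onto K L x L≤2^K (index-bound P≤ρ ρ+P<2H)
    in r , r<L , (begin
      centre H (P + order K L r)  ≡⟨ cong (λ t → centre H (P + t)) order≡x ⟩
      centre H (P + x)            ≡⟨ cong (centre H) (m+[n∸m]≡n P≤ρ) ⟩
      centre H (residue H z)      ≡⟨ centre-residue {H} z (shell-upper z∈) ⟩
      z                           ∎)
    where open ≡-Reasoning

  -- No 3-term progression inside one shell: its residues modulo 2^K would
  -- form a progression of the `order` enumeration.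
  shellElem-no3AP : ∀ {r₁ r₂ r₃} → r₁ < r₂ → r₂ < r₃ → r₃ < L →
                    shellElem m r₁ ℤ.+ shellElem m r₃ ≢ + 2 ℤ.* shellElem m r₂
  shellElem-no3AP {r₁} {r₂} {r₃} r₁<r₂ r₂<r₃ r₃<L ap =
    order-no3AP K L L≤2^K r₁<r₂ r₂<r₃ r₃<L
      (subst (λ M → Congruent M (x₁ + x₃) (2 * x₂)) (sym (modulus m))
        (congruent-cancel (P + P) (x₁ + x₃) (2 * x₂)
          (subst₂ (Congruent (2 * H)) (shuffle P x₁ x₃) (distrib P x₂)
            (ap-residues (lift r₁ r₁<L) (lift r₂ r₂<L) (lift r₃ r₃<L) ap))))
    where
    x₁ = order K L r₁
    x₂ = order K L r₂
    x₃ = order K L r₃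
    r₂<L = <-trans r₂<r₃ r₃<L
    r₁<L = <-trans r₁<r₂ r₂<L
    lift : ∀ r → r < L → IsResidue (2 * H) (P + order K L r) (shellElem m r)
    lift r r<L = centre-congruent {H} (residue< r r<L)
    shuffle : ∀ p a b → p + a + (p + b) ≡ p + p + (a + b)
    shuffle = solve-∀
    distrib : ∀ p a → 2 * (p + a) ≡ p + p + 2 * a
    distrib = solve-∀

-- Positions 2 + k are grouped into blocks [2·16^m, 2·16^(m+1)) of length 30·16^m.
blockOf : ∀ k → ∃ λ m → InLevel 2 m (2 + k)
blockOf = level-exists 2

-- The permutation of ℤ: positions 0 and 1 hold the integers of magnitude 0,
-- block m lists the shell of level m in `shellElem` order.
perm : ℕ → ℤ
perm zero          = + 0
perm (suc zero)    = -[1+ 0 ]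
perm (suc (suc k)) = shellElem m (2 + k ∸ 2 * 16 ^ m)
  where m = proj₁ (blockOf k)

rank : ℕ → ℕ
rank zero          = 0
rank (suc zero)    = 0
rank (suc (suc k)) = suc (proj₁ (blockOf k))

block-offset< : ∀ {m n} → InLevel 2 m n → n ∸ 2 * 16 ^ m < 30 * 16 ^ m
block-offset< {m} {n} (inLevel lo hi) = +-cancelʳ-< (2 * 16 ^ m) (n ∸ 2 * 16 ^ m) (30 * 16 ^ m)
  (subst₂ _<_ (sym (m∸n+n≡m lo)) (block-length (16 ^ m)) hi)
  where
  block-length : ∀ p → 2 * (16 * p) ≡ 30 * p + 2 * p
  block-length = solve-∀

perm-block : ∀ {m n} → InLevel 2 m n → perm n ≡ shellElem m (n ∸ 2 * 16 ^ m)
perm-block {m} {n} l = at n (inLevel-≥ l) l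
  where
  at : ∀ n → 2 ≤ n → InLevel 2 m n → perm n ≡ shellElem m (n ∸ 2 * 16 ^ m)
  at (suc zero)    (s≤s ()) _
  at (suc (suc k)) _ l = cong (λ m′ → shellElem m′ (2 + k ∸ 2 * 16 ^ m′)) (inLevel-unique (proj₂ (blockOf k)) l)

rank-inLevel : ∀ {m} n → rank n ≡ suc m → InLevel 2 m n
rank-inLevel (suc (suc k)) refl = proj₂ (blockOf k)

perm-inShell : ∀ {m n} → InLevel 2 m n → InShell m (perm n)
perm-inShell {m} {n} l = subst (InShell m) (sym (perm-block l)) (shellElem-inShell m _ (block-offset< l))

rank-mono : ∀ {n n′} → n ≤ n′ → rank n ≤ rank n′
rank-mono {zero}        _ = z≤n
rank-mono {suc zero}    _ = z≤n
rank-mono {suc (suc k)} {suc zero} (s≤s ())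
rank-mono {suc (suc k)} {suc (suc k′)} n≤n′ = s≤s (inLevel-mono (proj₂ (blockOf k)) (proj₂ (blockOf k′)) n≤n′)

mag≤∣∣ : ∀ z → mag z ≤ ∣ z ∣
mag≤∣∣ (+ u)    = ≤-refl
mag≤∣∣ -[1+ a ] = n≤1+n a

∣∣≤1+mag : ∀ z → ∣ z ∣ ≤ suc (mag z)
∣∣≤1+mag (+ u)    = n≤1+n u
∣∣≤1+mag -[1+ a ] = ≤-refl

perm-small : ∀ n → ∣ perm n ∣ ≤ 16 ^ rank n
perm-small zero          = z≤n
perm-small (suc zero)    = ≤-refl
perm-small (suc (suc k)) = ≤-trans (∣∣≤1+mag (perm (2 + k))) (shell-upper (perm-inShell (proj₂ (blockOf k))))

perm-large : ∀ n {t} → t < rank n → 16 ^ t ≤ ∣ perm n ∣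
perm-large n {t} t<rank with rank n in rank≡
... | suc m = ≤-trans (^-monoʳ-≤ 16 (≤-pred t<rank))
                     (≤-trans (shell-lower (perm-inShell (rank-inLevel n rank≡))) (mag≤∣∣ (perm n)))

block-injective : ∀ {m n n′} → InLevel 2 m n → InLevel 2 m n′ → perm n ≡ perm n′ → n ≡ n′
block-injective {m} l l′ eq = ∸-cancelʳ-≡ (InLevel.lower l) (InLevel.lower l′)
  (shellElem-injective m (block-offset< l) (block-offset< l′)
    (trans (sym (perm-block l)) (trans eq (perm-block l′))))

block-mag-positive : ∀ k → 0 < mag (perm (2 + k))
block-mag-positive k = <-≤-trans (m^n>0 16 m) (shell-lower (perm-inShell (proj₂ (blockOf k))))
  where m = proj₁ (blockOf k)

perm-injective : ∀ n n′ → perm n ≡ perm n′ → n ≡ n′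
perm-injective zero          zero           _  = refl
perm-injective (suc zero)    (suc zero)     _  = refl
perm-injective zero          (suc zero)     ()
perm-injective (suc zero)    zero           ()
perm-injective zero          (suc (suc k′)) eq = contradiction (cong mag eq) (<⇒≢ (block-mag-positive k′))
perm-injective (suc zero)    (suc (suc k′)) eq = contradiction (cong mag eq) (<⇒≢ (block-mag-positive k′))
perm-injective (suc (suc k)) zero           eq = contradiction (cong mag (sym eq)) (<⇒≢ (block-mag-positive k))
perm-injective (suc (suc k)) (suc zero)     eq = contradiction (cong mag (sym eq)) (<⇒≢ (block-mag-positive k))
perm-injective (suc (suc k)) (suc (suc k′)) eq =
  block-injective l (subst (λ m → InLevel 2 m (2 + k′)) (sym same-level) l′) eq
  where
  l  = proj₂ (blockOf k)
  l′ = proj₂ (blockOf k′)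
  same-level : proj₁ (blockOf k) ≡ proj₁ (blockOf k′)
  same-level = inLevel-unique (shell⇒level (perm-inShell l))
                              (shell⇒level (subst (InShell _) (sym eq) (perm-inShell l′)))

shell-covered : ∀ {m z} → InShell m z → ∃ λ n → perm n ≡ z
shell-covered {m} {z} z∈ =
  let (r , r<L , r↦z) = shellElem-onto m z z∈
      n = 2 * 16 ^ m + r
      l : InLevel 2 m n
      l = inLevel (m≤m+n (2 * 16 ^ m) r) (subst (n <_) (block-end (16 ^ m)) (+-monoʳ-< (2 * 16 ^ m) r<L))
  in n , trans (perm-block l) (trans (cong (shellElem m) (m+n∸m≡n (2 * 16 ^ m) r)) r↦z)
  where
  block-end : ∀ p → 2 * p + 30 * p ≡ 2 * (16 * p)
  block-end = solve-∀

perm-onto : ∀ z → ∃ λ n → perm n ≡ z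
perm-onto (+ zero)        = 0 , refl
perm-onto -[1+ zero ]     = 1 , refl
perm-onto (+ suc j)       = shell-covered (level⇒shell (proj₂ (level-exists 1 j)))
perm-onto -[1+ suc j ]    = shell-covered (level⇒shell (proj₂ (level-exists 1 j)))

perm-no3AP-sameRank : ∀ {n₁ n₂} n₃ → n₁ < n₂ → n₂ < n₃ → rank n₁ ≡ rank n₃ →
                      perm n₁ ℤ.+ perm n₃ ≢ + 2 ℤ.* perm n₂
perm-no3AP-sameRank (suc zero) () (s≤s z≤n)
perm-no3AP-sameRank {n₁} {n₂} n₃@(suc (suc k₃)) n₁<n₂ n₂<n₃ same ap =
  shellElem-no3AP m (∸-monoˡ-< n₁<n₂ (InLevel.lower l₁)) (∸-monoˡ-< n₂<n₃ (InLevel.lower l₂))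
                  (block-offset< l₃) (begin
    shellElem m (n₁ ∸ 2 * 16 ^ m) ℤ.+ shellElem m (n₃ ∸ 2 * 16 ^ m)  ≡⟨ cong₂ ℤ._+_ (perm-block l₁) (perm-block l₃) ⟨
    perm n₁ ℤ.+ perm n₃                                              ≡⟨ ap ⟩
    + 2 ℤ.* perm n₂                                                  ≡⟨ cong (+ 2 ℤ.*_) (perm-block l₂) ⟩
    + 2 ℤ.* shellElem m (n₂ ∸ 2 * 16 ^ m)                            ∎)
  where
  open ≡-Reasoning
  m  = proj₁ (blockOf k₃)
  l₃ = proj₂ (blockOf k₃)
  l₁ = rank-inLevel n₁ same
  l₂ = inLevel-between l₁ l₃ (<⇒≤ n₁<n₂) (<⇒≤ n₂<n₃)

rank-jump : ∀ {n₁ n₂ n₃} → n₁ < n₂ → n₂ < n₃ → perm n₁ ℤ.+ perm n₃ ≡ + 2 ℤ.* perm n₂ → rank n₁ < rank n₃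
rank-jump {n₃ = n₃} n₁<n₂ n₂<n₃ ap =
  ≤∧≢⇒< (rank-mono (<⇒≤ (<-trans n₁<n₂ n₂<n₃))) (λ same → perm-no3AP-sameRank n₃ n₁<n₂ n₂<n₃ same ap)

HasAPSeq-shorten : ∀ {k k′} {p : ℕ → ℤ} → k ≤ k′ → HasAPSeq k′ p → HasAPSeq k p
HasAPSeq-shorten k≤k′ (idx , increasing , a , d , d≢0 , term) =
  (λ j → idx (inject≤ j k≤k′)) ,
  (λ i j i<j → increasing _ _ (subst₂ _<_ (sym (toℕ-inject≤ i k≤k′)) (sym (toℕ-inject≤ j k≤k′)) i<j)) ,
  a , d , d≢0 ,
  (λ j → trans (term (inject≤ j k≤k′)) (cong (λ t → a ℤ.+ + t ℤ.* d) (toℕ-inject≤ j k≤k′)))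

combination-bound : ∀ b c {x y R} → ∣ x ∣ ≤ R → ∣ y ∣ ≤ R → ∣ + b ℤ.* x ℤ.- + c ℤ.* y ∣ ≤ (b + c) * R
combination-bound b c {x} {y} {R} x≤R y≤R = begin
  ∣ + b ℤ.* x ℤ.- + c ℤ.* y ∣       ≤⟨ ℤ.∣i-j∣≤∣i∣+∣j∣ (+ b ℤ.* x) (+ c ℤ.* y) ⟩
  ∣ + b ℤ.* x ∣ + ∣ + c ℤ.* y ∣     ≡⟨ cong₂ _+_ (ℤ.abs-* (+ b) x) (ℤ.abs-* (+ c) y) ⟩
  b * ∣ x ∣ + c * ∣ y ∣             ≤⟨ +-mono-≤ (*-monoʳ-≤ b x≤R) (*-monoʳ-≤ c y≤R) ⟩
  b * R + c * R                     ≡⟨ *-distribʳ-+ R b c ⟨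
  (b + c) * R                       ∎
  where open ≤-Reasoning

consecutive : ∀ a d j → (a ℤ.+ + j ℤ.* d) ℤ.+ (a ℤ.+ + (2 + j) ℤ.* d) ≡ + 2 ℤ.* (a ℤ.+ + (1 + j) ℤ.* d)
consecutive a d j = identity a d (+ j)
  where
  identity : ∀ a d J → (a ℤ.+ J ℤ.* d) ℤ.+ (a ℤ.+ (+ 2 ℤ.+ J) ℤ.* d) ≡ + 2 ℤ.* (a ℤ.+ (+ 1 ℤ.+ J) ℤ.* d)
  identity = ℤSolver.solve-∀

sixth-term : ∀ a d → a ℤ.+ + 5 ℤ.* d ≡ + 5 ℤ.* (a ℤ.+ + 1 ℤ.* d) ℤ.- + 4 ℤ.* (a ℤ.+ + 0 ℤ.* d)
sixth-term = ℤSolver.solve-∀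

-- The permutation has no 6-term progression x₀,…,x₅: ranks strictly increase
-- from x₁ to x₃ to x₅, so |x₅| ≥ 16·16^rank(x₁), whereas
-- |x₅| = |5x₁ − 4x₀| ≤ 9·16^rank(x₁).
perm-no6AP : ¬ HasAPSeq 6 perm
perm-no6AP (idx , increasing , a , d , _ , term) = <⇒≱ nine<sixteen (begin
  16 * R                           ≤⟨ perm-large (idx (# 5)) (≤-<-trans rank₁<rank₃ rank₃<rank₅) ⟩
  ∣ x (# 5) ∣                      ≡⟨ cong ∣_∣ fifth ⟩
  ∣ + 5 ℤ.* x (# 1) ℤ.- + 4 ℤ.* x (# 0) ∣  ≤⟨ combination-bound 5 4 {x (# 1)} {x (# 0)} small₁ small₀ ⟩
  9 * R                            ∎)
  where
  open ≤-Reasoning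
  x : Fin 6 → ℤ
  x j = perm (idx j)
  R = 16 ^ rank (idx (# 1))
  rank₁<rank₃ : rank (idx (# 1)) < rank (idx (# 3))
  rank₁<rank₃ = rank-jump (increasing (# 1) (# 2) ≤-refl) (increasing (# 2) (# 3) ≤-refl)
    (trans (cong₂ ℤ._+_ (term (# 1)) (term (# 3))) (trans (consecutive a d 1) (cong (+ 2 ℤ.*_) (sym (term (# 2))))))
  rank₃<rank₅ : rank (idx (# 3)) < rank (idx (# 5))
  rank₃<rank₅ = rank-jump (increasing (# 3) (# 4) ≤-refl) (increasing (# 4) (# 5) ≤-refl)
    (trans (cong₂ ℤ._+_ (term (# 3)) (term (# 5))) (trans (consecutive a d 3) (cong (+ 2 ℤ.*_) (sym (term (# 4))))))
  fifth : x (# 5) ≡ + 5 ℤ.* x (# 1) ℤ.- + 4 ℤ.* x (# 0)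
  fifth = trans (term (# 5)) (trans (sixth-term a d)
                (sym (cong₂ (λ s t → + 5 ℤ.* s ℤ.- + 4 ℤ.* t) (term (# 1)) (term (# 0)))))
  small₁ : ∣ x (# 1) ∣ ≤ R
  small₁ = perm-small (idx (# 1))
  small₀ : ∣ x (# 0) ∣ ≤ R
  small₀ = ≤-trans (perm-small (idx (# 0))) (^-monoʳ-≤ 16 (rank-mono (<⇒≤ (increasing (# 0) (# 1) ≤-refl))))
  nine<sixteen : 9 * R < 16 * R
  nine<sixteen = *-monoˡ-< R {{m^n≢0 16 (rank (idx (# 1)))}} (m<m+n 9 {7} z<s)

window : ℕ → List ℤ
window n = map (λ i → (+ i) ℤ.- (+ n)) (upTo (suc (n + n)))

window-length : ∀ n → length (window n) ≡ suc (n + n)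
window-length n = trans (List.length-map _ (upTo (suc (n + n)))) (List.length-upTo (suc (n + n)))

count-≤ : ∀ S n → count S n ≤ suc (n + n)
count-≤ S n = ≤-trans (List.length-filter (T? ∘ S) (window n)) (≤-reflexive (window-length n))

filter-all : ∀ (xs : List ℤ) → filterᵇ (λ _ → true) xs ≡ xs
filter-all []       = refl
filter-all (x ∷ xs) = cong (x ∷_) (filter-all xs)

count-all : ∀ n → count (λ _ → true) n ≡ suc (n + n)
count-all n = trans (cong length (filter-all (window n))) (window-length n)

density-fraction : ∀ S n → ℚ.toℚᵘ (density S n) ℚᵘ.≃ mkℚᵘ (+ count S (suc n)) (n + suc n)
density-fraction S n = subst (λ D → ℚ.toℚᵘ (density S n) ℚᵘ.≃ mkℚᵘ (+ count S (suc n)) (n + D))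
  (+-identityʳ (suc n)) (ℚ.toℚᵘ-fromℚᵘ (mkℚᵘ (+ count S (suc n)) (n + (suc n + 0))))

-- c(E+1) ≤ (E+1+K+1)(D+1) whenever c ≤ D+2 and E ≤ D: the cross-multiplied
-- form of c/(D+1) ≤ 1 + (K+1)/(E+1).
cross-≤ : ∀ c D E K → c ≤ 2 + D → E ≤ D → c * suc E ≤ (suc E + suc K) * suc D
cross-≤ c D E K c≤ E≤D = begin
  c * suc E                          ≤⟨ *-monoˡ-≤ (suc E) c≤ ⟩
  (2 + D) * suc E                    ≡⟨ expand D E ⟩
  suc D * suc E + suc E              ≤⟨ +-monoʳ-≤ (suc D * suc E) (≤-trans (s≤s E≤D) (m≤m*n (suc D) (suc K))) ⟩
  suc D * suc E + suc D * suc K      ≡⟨ collect D E K ⟩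
  (suc E + suc K) * suc D            ∎
  where
  open ≤-Reasoning
  expand : ∀ D E → (2 + D) * suc E ≡ suc D * suc E + suc E
  expand = solve-∀
  collect : ∀ D E K → suc D * suc E + suc D * suc K ≡ (suc E + suc K) * suc D
  collect = solve-∀

fraction-≤-1+ : ∀ {c D k e} → c ≤ 2 + D → e ≤ D →
                mkℚᵘ (+ c) D ℚᵘ.≤ mkℚᵘ (+ 1) 0 ℚᵘ.+ mkℚᵘ (+ suc k) e
fraction-≤-1+ {c} {D} {k} {e} c≤ e≤D = ℚᵘ.*≤* (subst₂ ℤ._≤_ (ℤ.pos-* c (suc E)) (ℤ.pos-* (suc E + suc K) (suc D))
  (ℤ.+≤+ (cross-≤ c D E K c≤ (subst (_≤ D) (sym (+-identityʳ e)) e≤D))))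
  where
  -- e and k in the shape produced by unfolding ℚᵘ addition
  E = e + 0 * suc e
  K = k * 1

one-≤-fraction : ∀ {C D} → suc D ≤ C → mkℚᵘ (+ 1) 0 ℚᵘ.≤ mkℚᵘ (+ C) D
one-≤-fraction {C} {D} D<C = ℚᵘ.*≤* (subst₂ ℤ._≤_ (ℤ.pos-* 1 (suc D)) (ℤ.pos-* C 1)
  (ℤ.+≤+ (subst₂ _≤_ (sym (*-identityˡ (suc D))) (sym (*-identityʳ C)) D<C)))

-- Every set has density at most 1 + ε from n = ↧ε on: |S ∩ [-n,n]| ≤ 2n + 1.
density-upper : ∀ S ε → 0ℚ ℚ.< ε → ∃ λ N → ∀ n → N ≤ n → density S n ℚ.≤ 1ℚ ℚ.+ ε
density-upper S (mkℚ (+ zero)   _ _) (ℚ.*<* (ℤ.+<+ ()))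
density-upper S (mkℚ -[1+ _ ]   _ _) (ℚ.*<* ())
density-upper S ε@(mkℚ (+ suc k) e _) _ = e , λ n e≤n →
  ℚ.toℚᵘ-cancel-≤ (ℚᵘ.≤-respˡ-≃ (ℚᵘ.≃-sym (density-fraction S n))
    (ℚᵘ.≤-respʳ-≃ (ℚᵘ.≃-sym (ℚ.toℚᵘ-homo-+ 1ℚ ε))
      (fraction-≤-1+ {k = k} (count-≤ S (suc n)) (≤-trans e≤n (m≤m+n n (suc n))))))

density-all : ∀ ε → 0ℚ ℚ.< ε → ∀ n → 1ℚ ℚ.- ε ℚ.< density (λ _ → true) n
density-all ε 0<ε n = ℚ.<-≤-trans (subst (1ℚ ℚ.- ε ℚ.<_) (ℚ.+-identityʳ 1ℚ) (ℚ.+-monoʳ-< 1ℚ (ℚ.neg-antimono-< 0<ε)))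
  (ℚ.toℚᵘ-cancel-≤ (ℚᵘ.≤-respʳ-≃ (ℚᵘ.≃-sym (density-fraction (λ _ → true) n))
    (one-≤-fraction (subst (suc (n + suc n) ≤_) (sym (count-all (suc n))) (s≤s (n≤1+n (n + suc n)))))))

ℤ-avoids : ∀ k → 6 ≤ k → CanAvoidAP k (λ _ → true)
ℤ-avoids k 6≤k =
  inj₂ (perm , (perm-injective , (λ _ → refl) , (λ z _ → perm-onto z)) , perm-no6AP ∘ HasAPSeq-shorten {p = perm} 6≤k)

mainTheorem2 : ∀ (k : ℕ) → 6 ≤ k → AlphaIsOne k × BetaIsOne k
mainTheorem2 k 6≤k =
  ( (λ S _ → density-upper S)
  , (λ ε 0<ε → (λ _ → true) , ℤ-avoids k 6≤k , λ N → N , ≤-refl , density-all ε 0<ε N) )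
  , ( (λ S _ ε 0<ε N → let (M , eventually) = density-upper S ε 0<ε
                       in N + M , m≤m+n N M , eventually (N + M) (m≤n+m M N))
    , (λ ε 0<ε → (λ _ → true) , ℤ-avoids k 6≤k , 0 , λ n _ → density-all ε 0<ε n) )
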